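{- Let $G$ be a bipartite Pfaffian graph with a fixed Pfaffian orientation $\vec G$, let $e=\{s,t\}\in E(G)$ with $(s,t)\in E(\vec G)$, and let $\chi:V(G)\to\{0,1\}$ be a good coloring. Then the orientation $\vec G_e^{\chi}\setminus(t,s)$ of $G\setminus e$ is acyclic, with $s$ its unique source vertex and $t$ its unique sink vertex. Moreover, the longest directed path in $\vec G_e^{\chi}\setminus(t,s)$ is unique and is a directed Hamiltonian path.
   Context: Graphs are finite, undirected, simple. An orientation chooses one direction per edge. A cycle $C$ of $G$ is central if $G\setminus V(C)$ has a perfect matching; an orientation of a cycle is consistent if it is a directed cycle; an orientation $\vec G$ is Pfaffian if for every central cycle $C$, each of the two consistent orientations of $C$ shares an odd number of arcs with $\vec G$. Let $\vec G_e$ be the orientation obtained from $\vec G$ by replacing the arc $(s,t)$ by $(t,s)$. An anchored Hamiltonian cycle is a Hamiltonian cycle $H$ of $G$ with $e\in E(H)$; list its vertices as $v_0=s,v_1,\dots,v_{n-1}=t$ in order along $H$ (so $\{v_{n-1},v_0\}=e$), and define $\chi_H:V(G)\to\{0,1\}$ by $\chi_H(v_0)=0$ and $\chi_H(v_{i+1})\equiv\chi_H(v_i)+[(v_i,v_{i+1})\in E(\vec G_e)]\pmod 2$ for $i=0,\dots,n-2$, where $[P]$ is $1$ if $P$ holds and $0$ otherwise. A coloring $\chi:V(G)\to\{0,1\}$ is good if $\chi=\chi_H$ for some anchored Hamiltonian cycle $H$ (such $\chi$ satisfy $\chi(s)=0,\chi(t)=1$). For $\chi$ with $\chi(s)=0,\chi(t)=1$,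 the induced orientation $\vec G_e^{\chi}$ is the orientation of $G$ in which, for each edge $\{u,w\}$, $(u,w)\in E(\vec G_e^{\chi})$ iff $\chi(w)\equiv\chi(u)+[(u,w)\in E(\vec G_e)]\pmod 2$; it contains the arc $(t,s)$. -}

module Defs where

open import Data.Nat using (ℕ; zero; suc; _≤_; _%_)
open import Data.Bool using (Bool; true; false; _∧_; _∨_; _xor_; not)
open import Data.Fin using (Fin) renaming (_≟_ to _≟ᶠ_)
open import Data.List using (List; []; _∷_; _++_; length)
open import Data.List.Relation.Unary.Linked using (Linked)
open import Data.List.Relation.Unary.Unique.Propositional using (Unique)
open import Data.List.Membership.Propositional using (_∈_)
open import Data.Product using (Σ; ∃; ∃-syntax; _×_; _,_)
open import Relation.Binary.PropositionalEquality using (_≡_; _≢_)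
open import Relation.Nullary.Decidable using (⌊_⌋)
open import Relation.Nullary using (¬_)

record Graph (n : ℕ) : Set where
  field
    adj     : Fin n → Fin n → Bool
    symm    : ∀ u w → adj u w ≡ adj w u
    irrefl  : ∀ u → adj u u ≡ false
open Graph public

Digraph : ℕ → Set
Digraph n = Fin n → Fin n → Bool

IsOrientation : ∀ {n} → Graph n → Digraph n → Set
IsOrientation G D = ∀ u w → (D u w ∨ D w u ≡ adj G u w) × (D u w ∧ D w u ≡ false)

Bipartite : ∀ {n} → Graph n → Set
Bipartite {n} G = Σ (Fin n → Bool) λ c → (∀ (u w : Fin n) → adj G u w ≡ true → c u ≢ c w)



pairs : ∀ {A : Set} → List A → List (A × A)
pairs []           = []
pairs (x ∷ [])     = []
pairs (x ∷ y ∷ xs) = (x , y) ∷ pairs (y ∷ xs)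

close : ∀ {A : Set} → List A → List A
close []       = []
close (x ∷ xs) = x ∷ xs ++ x ∷ []

IsCycle : ∀ {n} → Graph n → List (Fin n) → Set
IsCycle G C = (3 ≤ length C) × Unique C × Linked (λ a b → adj G a b ≡ true) (close C)

-- G minus the vertex set S has a perfect matching, given by a partner map m
-- that is a fixed-point-free involution on the complement of S along edges of G.
HasPMAvoiding : ∀ {n} → Graph n → List (Fin n) → Set
HasPMAvoiding {n} G S =
  Σ (Fin n → Fin n) λ m → ∀ v → ¬ (v ∈ S) →
    (¬ (m v ∈ S)) × (m (m v) ≡ v) × (adj G v (m v) ≡ true)

Central : ∀ {n} → Graph n → List (Fin n) → Set
Central G C = IsCycle G C × HasPMAvoiding G C

countFwd : ∀ {n} → Digraph n → List (Fin n × Fin n) → ℕ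
countFwd D []             = 0
countFwd D ((x , y) ∷ ps) = (if D x y then 1 else 0) + countFwd D ps
  where open import Data.Bool using (if_then_else_)
        open import Data.Nat using (_+_)

countBwd : ∀ {n} → Digraph n → List (Fin n × Fin n) → ℕ
countBwd D []             = 0
countBwd D ((x , y) ∷ ps) = (if D y x then 1 else 0) + countBwd D ps
  where open import Data.Bool using (if_then_else_)
        open import Data.Nat using (_+_)

OddN : ℕ → Set
OddN k = k % 2 ≡ 1

-- Pfaffian orientation: for each central cycle, both consistent orientations
-- share an odd number of arcs with D.
IsPfaffian : ∀ {n} → Graph n → Digraph n → Set
IsPfaffian G D = IsOrientation G D ×
  (∀ C → Central G C → OddN (countFwd D (pairs (close C))) × OddN (countBwd D (pairs (close C))))

_==_ : ∀ {n} → Fin n → Fin n → Bool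
u == w = ⌊ u ≟ᶠ w ⌋

-- G⃗_e : reverse the arc (s,t) to (t,s)
flipArc : ∀ {n} → Digraph n → Fin n → Fin n → Digraph n
flipArc D s t u w = D u w xor ((u == s ∧ w == t) ∨ (u == t ∧ w == s))

-- Anchored Hamiltonian cycle, listed as v0 = s, v1, …, v_{n-1} = t (edge {t,s} in H),
-- together with the statement that χ = χ_H (χ_H(v0) = 0 and
-- χ_H(v_{i+1}) = χ_H(v_i) + [(v_i,v_{i+1}) ∈ G⃗_e] mod 2).  Colors: false = 0, true = 1.
GoodColoring : ∀ {n} → Graph n → Digraph n → Fin n → Fin n → (Fin n → Bool) → Set
GoodColoring {n} G D s t χ =
  Σ (List (Fin n)) λ mid →
    let H = s ∷ mid ++ t ∷ [] in
      IsCycle G H × (∀ v → v ∈ H)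
      × (χ s ≡ false)
      × Linked (λ a b → χ b ≡ (χ a xor flipArc D s t a b)) H

induced : ∀ {n} → Graph n → Digraph n → Fin n → Fin n → (Fin n → Bool) → Digraph n
induced G D s t χ u w = adj G u w ∧ not (χ w xor (χ u xor flipArc D s t u w))

removeArc : ∀ {n} → Digraph n → Fin n → Fin n → Digraph n
removeArc D t s u w = D u w ∧ not (u == t ∧ w == s)

IsDirectedCycle : ∀ {n} → Digraph n → List (Fin n) → Set
IsDirectedCycle D C = (1 ≤ length C) × Unique C × Linked (λ a b → D a b ≡ true) (close C)

Acyclic : ∀ {n} → Digraph n → Set
Acyclic D = ∀ C → ¬ IsDirectedCycle D C

IsSource : ∀ {n} → Digraph n → Fin n → Set
IsSource D v = ∀ u → D u v ≡ false

IsSink : ∀ {n} → Digraph n → Fin n → Set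
IsSink D v = ∀ u → D v u ≡ false

UniqueSource : ∀ {n} → Digraph n → Fin n → Set
UniqueSource D s = IsSource D s × (∀ v → IsSource D v → v ≡ s)

UniqueSink : ∀ {n} → Digraph n → Fin n → Set
UniqueSink D t = IsSink D t × (∀ v → IsSink D v → v ≡ t)

IsDirectedPath : ∀ {n} → Digraph n → List (Fin n) → Set
IsDirectedPath D P = (1 ≤ length P) × Unique P × Linked (λ a b → D a b ≡ true) P

IsLongestPath : ∀ {n} → Digraph n → List (Fin n) → Set
IsLongestPath D P = IsDirectedPath D P × (∀ Q → IsDirectedPath D Q → length Q ≤ length P)

IsHamiltonianPath : ∀ {n} → Digraph n → List (Fin n) → Set
IsHamiltonianPath D P = IsDirectedPath D P × (∀ v → v ∈ P)

-- List the anchored Hamiltonian cycle H as positions 0 = s, 1, …, T = t. By the definition of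
-- χ = χ_H, every edge of H other than {t,s} is oriented forwards in G⃗ₑ^χ, so it suffices to show
-- that no arc of G⃗ₑ^χ ∖ (t,s) points backwards along H: then positions strictly increase along
-- arcs, which gives acyclicity, the unique source and sink, and H ∖ {t,s} as the unique longest
-- path. A backward arc between consecutive vertices would orient one edge of G⃗ₑ both ways. A
-- backward chord from position j + m to j (m ≥ 2) closes the cycle C on positions j … j + m.
-- Bipartiteness makes m odd and |H| even, so the rest of H is a path with an even number of
-- vertices and C is central. But G⃗ₑ agrees with G⃗ on C, and every arc (a,b) of C satisfies
-- χ(b) = χ(a) + [(a,b) ∈ G⃗], so going once around C shows that C shares an even number of arcs
-- with G⃗, contradicting the Pfaffian property.

module Submission where

open import Defs
open import Data.Bool using (Bool; true; false; not; _∧_; _∨_; _xor_; if_then_else_)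
open import Data.Bool.Properties
  using (¬-not; not-¬; not-involutive; xor-same; xor-identityʳ; xor-is-ok; xor-inverseʳ;
         not-distribˡ-xor; not-distribʳ-xor; ∧-comm; ∨-comm)
open import Data.Empty using (⊥-elim)
open import Data.Fin using (Fin) renaming (_≟_ to _≟ᶠ_)
open import Data.List using (List; []; _∷_; _++_; _∷ʳ_; length; drop; applyUpTo)
open import Data.List.Properties using (length-++; applyUpTo-∷ʳ; length-applyUpTo; drop-all)
open import Data.List.Membership.Propositional using (_∈_; _∉_)
open import Data.List.Membership.Propositional.Properties using (∈-applyUpTo⁺; ∈-applyUpTo⁻)
import Data.List.Relation.Unary.All as All
open import Data.List.Relation.Unary.AllPairs using (_∷_)
open import Data.List.Relation.Unary.Linked using (Linked; []; [-]; _∷_)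
import Data.List.Relation.Unary.Linked.Properties as Linked
open import Data.List.Relation.Unary.Unique.Propositional using (Unique)
import Data.List.Relation.Unary.Unique.Propositional.Properties as Unique
open import Data.Nat using (ℕ; zero; suc; _+_; _≤_; _<_; z≤n; s≤s; _≟_; _<?_; _≤?_)
open import Data.Nat.Properties
open import Data.Product using (Σ; ∃; _×_; _,_; proj₁; proj₂)
open import Data.Sum using (_⊎_; inj₁; inj₂; [_,_]′)
open import Function using (_∘_)
open import Relation.Binary.PropositionalEquality
open import Relation.Nullary using (¬_; yes; no)
open import Relation.Nullary.Decidable using (isYes≗does; dec-true; dec-false)

∧-true : ∀ {a b} → a ∧ b ≡ true → a ≡ true × b ≡ true
∧-true {true} {true} _ = refl , refl

∧-false : ∀ {a b} → ¬ (a ≡ true × b ≡ true) → a ∧ b ≡ false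
∧-false {true} {true} both = ⊥-elim (both (refl , refl))
∧-false {true} {false} _ = refl
∧-false {false} _ = refl

not-xor≡true⇒≡ : ∀ {x y} → not (x xor y) ≡ true → x ≡ y
not-xor≡true⇒≡ {true} {true} _ = refl
not-xor≡true⇒≡ {false} {false} _ = refl

xor-cancelʳ : ∀ p q x → (p xor x) xor (q xor x) ≡ p xor q
xor-cancelʳ true  true  true  = refl
xor-cancelʳ true  true  false = refl
xor-cancelʳ true  false true  = refl
xor-cancelʳ true  false false = refl
xor-cancelʳ false true  true  = refl
xor-cancelʳ false true  false = refl
xor-cancelʳ false false true  = refl
xor-cancelʳ false false false = refl

xor-telescope : ∀ a d z → d xor ((a xor d) xor z) ≡ a xor z
xor-telescope true  true  true  = refl
xor-telescope true  true  false = refl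
xor-telescope true  false true  = refl
xor-telescope true  false false = refl
xor-telescope false true  true  = refl
xor-telescope false true  false = refl
xor-telescope false false true  = refl
xor-telescope false false false = refl

xor-round-trip : ∀ x p q → x ≡ (x xor p) xor q → p xor q ≡ false
xor-round-trip true  true  true  _ = refl
xor-round-trip true  false false _ = refl
xor-round-trip false true  true  _ = refl
xor-round-trip false false false _ = refl
xor-round-trip true  true  false ()
xor-round-trip true  false true  ()
xor-round-trip false true  false ()
xor-round-trip false false true  ()

odd : ℕ → Bool
odd zero = false
odd (suc k) = not (odd k)

OddN⇒odd : ∀ k → OddN k → odd k ≡ true
OddN⇒odd (suc zero) _ = refl
OddN⇒odd (suc (suc k)) p = trans (not-involutive (odd k)) (OddN⇒odd k p)

odd-if : ∀ b k → odd ((if b then 1 else 0) + k) ≡ b xor odd k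
odd-if true  k = refl
odd-if false k = refl

module _ {n : ℕ} (D : Digraph n) (χ : Fin n → Bool) where

  Potential : Fin n → Fin n → Set
  Potential a b = χ b ≡ χ a xor D a b

  odd-countFwd-step : ∀ {a b y} rest → Potential a b →
    odd (countFwd D (pairs (b ∷ rest))) ≡ χ b xor χ y →
    odd (countFwd D (pairs (a ∷ b ∷ rest))) ≡ χ a xor χ y
  odd-countFwd-step {a} {b} {y} rest p ih = begin
    odd (countFwd D (pairs (a ∷ b ∷ rest)))  ≡⟨ odd-if (D a b) (countFwd D (pairs (b ∷ rest))) ⟩
    D a b xor odd (countFwd D (pairs (b ∷ rest)))  ≡⟨ cong (D a b xor_) (trans ih (cong (_xor χ y) p)) ⟩
    D a b xor ((χ a xor D a b) xor χ y)  ≡⟨ xor-telescope (χ a) (D a b) (χ y) ⟩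
    χ a xor χ y  ∎
    where open ≡-Reasoning

  odd-countFwd-walk : ∀ x xs y → Linked Potential (x ∷ xs ++ y ∷ []) →
    odd (countFwd D (pairs (x ∷ xs ++ y ∷ []))) ≡ χ x xor χ y
  odd-countFwd-walk x []       y (p ∷ [-]) = odd-countFwd-step [] p (sym (xor-same (χ y)))
  odd-countFwd-walk x (z ∷ zs) y (p ∷ ps)  = odd-countFwd-step (zs ++ y ∷ []) p (odd-countFwd-walk z zs y ps)

  odd-countFwd-closed : ∀ x xs → Linked Potential (close (x ∷ xs)) →
    odd (countFwd D (pairs (close (x ∷ xs)))) ≡ false
  odd-countFwd-closed x xs ps = trans (odd-countFwd-walk x xs x ps) (xor-same (χ x))

module _ {n : ℕ} where

  ==-refl : (u : Fin n) → (u == u) ≡ true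
  ==-refl u = trans (isYes≗does (u ≟ᶠ u)) (dec-true (u ≟ᶠ u) refl)

  ≢⇒==false : {u w : Fin n} → u ≢ w → (u == w) ≡ false
  ≢⇒==false {u} {w} u≢w = trans (isYes≗does (u ≟ᶠ w)) (dec-false (u ≟ᶠ w) u≢w)

  ==⇒≡ : {u w : Fin n} → (u == w) ≡ true → u ≡ w
  ==⇒≡ {u} {w} e with u ≟ᶠ w | e
  ... | yes u≡w | _ = u≡w

  flipArc-away : (D : Digraph n) {s t u w : Fin n} →
    ¬ (u ≡ s × w ≡ t) → ¬ (u ≡ t × w ≡ s) → flipArc D s t u w ≡ D u w
  flipArc-away D {u = u} {w} ¬st ¬ts =
    trans (cong (D u w xor_) (cong₂ _∨_ (∧-false (¬st ∘ ==⇒≡²)) (∧-false (¬ts ∘ ==⇒≡²))))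
          (xor-identityʳ (D u w))
    where
    ==⇒≡² : ∀ {a b c d : Fin n} → (a == b) ≡ true × (c == d) ≡ true → a ≡ b × c ≡ d
    ==⇒≡² (p , q) = ==⇒≡ p , ==⇒≡ q

  flipArc-antisym : {G : Graph n} {D : Digraph n} → IsOrientation G D → (s t : Fin n) →
    ∀ {u w} → adj G u w ≡ true → flipArc D s t u w xor flipArc D s t w u ≡ true
  flipArc-antisym {D = D} orientation s t {u} {w} edge = begin
    (D u w xor flipped) xor (D w u xor ((w == s ∧ u == t) ∨ (w == t ∧ u == s)))
      ≡⟨ cong (λ b → (D u w xor flipped) xor (D w u xor b)) same-pair ⟩
    (D u w xor flipped) xor (D w u xor flipped)  ≡⟨ xor-cancelʳ (D u w) (D w u) flipped ⟩
    D u w xor D w u  ≡⟨ xor-is-ok (D u w) (D w u) ⟩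
    (D u w ∨ D w u) ∧ not (D u w ∧ D w u)
      ≡⟨ cong₂ (λ a b → a ∧ not b) (trans (proj₁ (orientation u w)) edge) (proj₂ (orientation u w)) ⟩
    true  ∎
    where
    open ≡-Reasoning
    flipped : Bool
    flipped = (u == s ∧ w == t) ∨ (u == t ∧ w == s)
    same-pair : (w == s ∧ u == t) ∨ (w == t ∧ u == s) ≡ flipped
    same-pair = trans (cong₂ _∨_ (∧-comm (w == s) (u == t)) (∧-comm (w == t) (u == s)))
                      (∨-comm (u == t ∧ w == s) (u == s ∧ w == t))

  removeArc⁻ : {E : Digraph n} {t s u w : Fin n} → removeArc E t s u w ≡ true →
    E u w ≡ true × ¬ (u ≡ t × w ≡ s)
  removeArc⁻ {E} {t} {s} {u} {w} arc = proj₁ kept , λ { (refl , refl) → not-¬ (proj₂ kept) (removed t s) }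
    where
    kept : E u w ≡ true × not (u == t ∧ w == s) ≡ true
    kept = ∧-true arc
    removed : ∀ a b → not (a == a ∧ b == b) ≡ false
    removed a b = cong₂ (λ x y → not (x ∧ y)) (==-refl a) (==-refl b)

  removeArc⁺ : {E : Digraph n} {t s u w : Fin n} → E u w ≡ true → u ≢ t → removeArc E t s u w ≡ true
  removeArc⁺ {s = s} {w = w} arc u≢t = cong₂ (λ a b → a ∧ not (b ∧ (w == s))) arc (≢⇒==false u≢t)

  module _ {G : Graph n} {D : Digraph n} {s t : Fin n} {χ : Fin n → Bool} {u w : Fin n} where

    induced⁻ : induced G D s t χ u w ≡ true → adj G u w ≡ true × χ w ≡ χ u xor flipArc D s t u w
    induced⁻ arc = proj₁ parts , not-xor≡true⇒≡ (proj₂ parts)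
      where
      parts : adj G u w ≡ true × not (χ w xor (χ u xor flipArc D s t u w)) ≡ true
      parts = ∧-true arc

    induced⁺ : adj G u w ≡ true → χ w ≡ χ u xor flipArc D s t u w → induced G D s t χ u w ≡ true
    induced⁺ edge agrees = trans
      (cong₂ (λ a b → a ∧ not (b xor (χ u xor flipArc D s t u w))) edge agrees)
      (cong (λ b → true ∧ not b) (xor-same (χ u xor flipArc D s t u w)))

module _ {A : Set} where

  linked-++⁻ˡ : {R : A → A → Set} (xs : List A) {ys : List A} → Linked R (xs ++ ys) → Linked R xs
  linked-++⁻ˡ []           _        = []
  linked-++⁻ˡ (x ∷ [])     _        = [-]
  linked-++⁻ˡ (x ∷ y ∷ xs) (r ∷ rs) = r ∷ linked-++⁻ˡ (y ∷ xs) rs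

  linked-∷ʳ : {R : A → A → Set} (xs : List A) {y z : A} →
    Linked R (xs ∷ʳ y) → R y z → Linked R (xs ∷ʳ y ∷ʳ z)
  linked-∷ʳ []           [-]      r = r ∷ [-]
  linked-∷ʳ (x ∷ [])     (q ∷ [-]) r = q ∷ r ∷ [-]
  linked-∷ʳ (x ∷ y ∷ xs) (q ∷ qs) r = q ∷ linked-∷ʳ (y ∷ xs) qs r

  module _ (default : A) where

    get : List A → ℕ → A
    get []       _       = default
    get (x ∷ xs) zero    = x
    get (x ∷ xs) (suc k) = get xs k

    applyUpTo-get : ∀ xs → applyUpTo (get xs) (length xs) ≡ xs
    applyUpTo-get []       = refl
    applyUpTo-get (x ∷ xs) = cong (x ∷_) (applyUpTo-get xs)

    get-∈ : ∀ xs {k} → k < length xs → get xs k ∈ xs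
    get-∈ xs k< = subst (get xs _ ∈_) (applyUpTo-get xs) (∈-applyUpTo⁺ (get xs) k<)

    get-∷ʳ-length : ∀ xs y → get (xs ∷ʳ y) (length xs) ≡ y
    get-∷ʳ-length []       y = refl
    get-∷ʳ-length (x ∷ xs) y = get-∷ʳ-length xs y

    get-injective : ∀ {xs} → Unique xs → ∀ {a b} → a < length xs → b < length xs →
      get xs a ≡ get xs b → a ≡ b
    get-injective {x ∷ xs} _        {zero}  {zero}  _        _        _ = refl
    get-injective {x ∷ xs} (x∉ ∷ _) {zero}  {suc b} _        (s≤s b<) e = ⊥-elim (All.lookup x∉ (get-∈ xs b<) e)
    get-injective {x ∷ xs} (x∉ ∷ _) {suc a} {zero}  (s≤s a<) _        e = ⊥-elim (All.lookup x∉ (get-∈ xs a<) (sym e))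
    get-injective {x ∷ xs} (_ ∷ u)  {suc a} {suc b} (s≤s a<) (s≤s b<) e = cong suc (get-injective u a< b< e)

    get-linked : {R : A → A → Set} {xs : List A} → Linked R xs →
      ∀ {a} → suc a < length xs → R (get xs a) (get xs (suc a))
    get-linked (r ∷ _)  {zero}  _        = r
    get-linked (_ ∷ rs) {suc a} (s≤s a<) = get-linked rs a<
    get-linked [-]      {_}     (s≤s ())

    drop-get : ∀ xs {k} → k < length xs → drop k xs ≡ get xs k ∷ drop (suc k) xs
    drop-get (x ∷ xs) {zero}  _        = refl
    drop-get (x ∷ xs) {suc k} (s≤s k<) = drop-get xs k<

module HamiltonianList {n : ℕ} (s t : Fin n) (mid : List (Fin n))
  (distinct : Unique (s ∷ mid ++ t ∷ [])) (covers : ∀ v → v ∈ s ∷ mid ++ t ∷ []) where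

  L : List (Fin n)
  L = s ∷ mid ++ t ∷ []

  N T : ℕ
  N = length L
  T = suc (length mid)

  N≡1+T : N ≡ suc T
  N≡1+T = cong suc (trans (length-++ mid) (+-comm (length mid) 1))

  <N⇒≤T : ∀ {k} → k < N → k ≤ T
  <N⇒≤T {k} k< = ≤-pred (subst (suc k ≤_) N≡1+T k<)

  ≤T⇒<N : ∀ {k} → k ≤ T → k < N
  ≤T⇒<N {k} k≤ = subst (suc k ≤_) (sym N≡1+T) (s≤s k≤)

  0<N : 0 < N
  0<N = s≤s z≤n

  T<N : T < N
  T<N = ≤T⇒<N ≤-refl

  ix : ℕ → Fin n
  ix = get s L

  ix-T : ix T ≡ t
  ix-T = get-∷ʳ-length s mid t

  ix-injective : ∀ {a b} → a < N → b < N → ix a ≡ ix b → a ≡ b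
  ix-injective = get-injective s distinct

  ix≡s⇒0 : ∀ {a} → a < N → ix a ≡ s → a ≡ 0
  ix≡s⇒0 a< e = ix-injective a< 0<N e

  ix≡t⇒T : ∀ {a} → a < N → ix a ≡ t → a ≡ T
  ix≡t⇒T a< e = ix-injective a< T<N (trans e (sym ix-T))

  position : ∀ v → ∃ λ a → a < N × v ≡ ix a
  position v = ∈-applyUpTo⁻ ix (subst (v ∈_) (sym (applyUpTo-get s L)) (covers v))

  pos : Fin n → ℕ
  pos v = proj₁ (position v)

  pos<N : ∀ v → pos v < N
  pos<N v = proj₁ (proj₂ (position v))

  ix-pos : ∀ v → ix (pos v) ≡ v
  ix-pos v = sym (proj₂ (proj₂ (position v)))

  pos-ix : ∀ {a} → a < N → pos (ix a) ≡ a
  pos-ix a< = ix-injective (pos<N _) a< (ix-pos _)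

  segment : ℕ → ℕ → List (Fin n)
  segment j m = applyUpTo (λ a → ix (j + a)) (suc m)

  segment-unique : ∀ j m → j + m < N → Unique (segment j m)
  segment-unique j m j+m<N = Unique.applyUpTo⁺₁ _ (suc m) λ a<b b≤m e →
    <⇒≢ a<b (+-cancelˡ-≡ j _ _ (ix-injective (inside (<-trans a<b b≤m)) (inside b≤m) e))
    where
    inside : ∀ {a} → a < suc m → j + a < N
    inside a≤m = ≤-<-trans (+-monoʳ-≤ j (≤-pred a≤m)) j+m<N

  ∈-segment⁻ : ∀ {v} j {m} → v ∈ segment j m → ∃ λ a → a ≤ m × v ≡ ix (j + a)
  ∈-segment⁻ j v∈ with ∈-applyUpTo⁻ _ v∈
  ... | a , a≤m , e = a , ≤-pred a≤m , e

  ∈-segment⁺ : ∀ {j k m} → j ≤ k → k ≤ j + m → ix k ∈ segment j m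
  ∈-segment⁺ {j} {k} {m} j≤k k≤j+m = subst (λ b → ix b ∈ segment j m) (m+[n∸m]≡n j≤k)
    (∈-applyUpTo⁺ (λ a → ix (j + a)) (s≤s (m≤n+o⇒m∸n≤o k j k≤j+m)))

  linked-close-segment : ∀ {R : Fin n → Fin n → Set} j m → j + m < N →
    (∀ a → suc a < N → R (ix a) (ix (suc a))) → R (ix (j + m)) (ix j) → Linked R (close (segment j m))
  linked-close-segment {R} j m j+m<N step closing =
    subst (λ xs → Linked R (xs ∷ʳ f 0)) (applyUpTo-∷ʳ f m)
      (linked-∷ʳ (applyUpTo f m) (subst (Linked R) (sym (applyUpTo-∷ʳ f m)) (Linked.applyUpTo⁺₁ f (suc m) step′))
        (subst (λ b → R (f m) (ix b)) (sym (+-identityʳ j)) closing))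
    where
    f : ℕ → Fin n
    f a = ix (j + a)
    step′ : ∀ {a} → suc a < suc m → R (f a) (f (suc a))
    step′ {a} a<m = subst (λ b → R (f a) (ix b)) (sym (+-suc j a))
      (step (j + a) (≤-<-trans (subst (_≤ j + m) (+-suc j a) (+-monoʳ-≤ j (≤-pred a<m))) j+m<N))

  pos-s : pos s ≡ 0
  pos-s = pos-ix 0<N

  pos-t : pos t ≡ T
  pos-t = trans (cong pos (sym ix-T)) (pos-ix T<N)

  module ForwardArcs (R : Digraph n) (forward : ∀ u w → R u w ≡ true → pos u < pos w) where

    Arc : Fin n → Fin n → Set
    Arc u w = R u w ≡ true

    walk-forward : ∀ x xs y → Linked Arc (x ∷ xs ++ y ∷ []) → pos x < pos y
    walk-forward x []       y (r ∷ [-]) = forward x y r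
    walk-forward x (z ∷ zs) y (r ∷ rs)  = <-trans (forward x z r) (walk-forward z zs y rs)

    acyclic : Acyclic R
    acyclic (x ∷ xs) (_ , _ , closed) = <-irrefl refl (walk-forward x xs x closed)

    s-source : IsSource R s
    s-source u = ¬-not λ arc → n≮0 (subst (pos u <_) pos-s (forward u s arc))

    t-sink : IsSink R t
    t-sink u = ¬-not λ arc → <⇒≱ (subst (_< pos u) pos-t (forward t u arc)) (<N⇒≤T (pos<N u))

    path-span : ∀ x xs → Linked Arc (x ∷ xs) → pos x + length (x ∷ xs) ≤ N
    path-span x []       _        = subst (_≤ N) (+-comm 1 (pos x)) (pos<N x)
    path-span x (y ∷ ys) (r ∷ rs) = begin
      pos x + suc (length (y ∷ ys))  ≡⟨ +-suc (pos x) (length (y ∷ ys)) ⟩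
      suc (pos x) + length (y ∷ ys)  ≤⟨ +-monoˡ-≤ (length (y ∷ ys)) (forward x y r) ⟩
      pos y + length (y ∷ ys)        ≤⟨ path-span y ys rs ⟩
      N                              ∎
      where open ≤-Reasoning

    path-length : ∀ P → IsDirectedPath R P → length P ≤ N
    path-length (x ∷ xs) (_ , _ , arcs) = ≤-trans (m≤n+m _ (pos x)) (path-span x xs arcs)

    spanning-path : ∀ x xs → Linked Arc (x ∷ xs) → pos x + length (x ∷ xs) ≡ N → x ∷ xs ≡ drop (pos x) L
    spanning-path x [] _ tight = begin
      x ∷ []                             ≡⟨ cong₂ _∷_ (sym (ix-pos x)) (sym (drop-all _ L (≤-reflexive ends))) ⟩
      ix (pos x) ∷ drop (suc (pos x)) L  ≡⟨ sym (drop-get s L (pos<N x)) ⟩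
      drop (pos x) L                     ∎
      where
      open ≡-Reasoning
      ends : N ≡ suc (pos x)
      ends = trans (sym tight) (+-comm (pos x) 1)
    spanning-path x (y ∷ ys) (r ∷ rs) tight = begin
      x ∷ y ∷ ys                         ≡⟨ cong₂ _∷_ (sym (ix-pos x)) (spanning-path y ys rs tight′) ⟩
      ix (pos x) ∷ drop (pos y) L        ≡⟨ cong (λ k → ix (pos x) ∷ drop k L) pos-y ⟩
      ix (pos x) ∷ drop (suc (pos x)) L  ≡⟨ sym (drop-get s L (pos<N x)) ⟩
      drop (pos x) L                     ∎
      where
      open ≡-Reasoning
      ℓ : ℕ
      ℓ = length (y ∷ ys)
      squeeze : pos y + ℓ ≡ suc (pos x) + ℓ
      squeeze = ≤-antisym (≤-trans (path-span y ys rs) (≤-reflexive (trans (sym tight) (+-suc (pos x) ℓ))))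
                          (+-monoˡ-≤ ℓ (forward x y r))
      pos-y : pos y ≡ suc (pos x)
      pos-y = +-cancelʳ-≡ ℓ _ _ squeeze
      tight′ : pos y + ℓ ≡ N
      tight′ = trans squeeze (trans (sym (+-suc (pos x) ℓ)) tight)

    module _ (along : ∀ a → suc a < N → R (ix a) (ix (suc a)) ≡ true) where

      L-path : IsDirectedPath R L
      L-path = 0<N , distinct ,
        subst (Linked Arc) (applyUpTo-get s L) (Linked.applyUpTo⁺₁ ix N (along _))

      L-longest : IsLongestPath R L
      L-longest = L-path , path-length

      longest-unique : ∀ P → IsLongestPath R P → P ≡ L
      longest-unique (x ∷ xs) ((nonempty , unique , arcs) , maximal) =
        trans (spanning-path x xs arcs tight) (cong (λ k → drop k L) at-0)
        where
        full : length (x ∷ xs) ≡ N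
        full = ≤-antisym (path-length _ (nonempty , unique , arcs)) (maximal L L-path)
        tight : pos x + length (x ∷ xs) ≡ N
        tight = ≤-antisym (path-span x xs arcs) (subst (_≤ pos x + length (x ∷ xs)) full (m≤n+m _ (pos x)))
        at-0 : pos x ≡ 0
        at-0 = +-cancelʳ-≡ (length (x ∷ xs)) (pos x) 0 (trans tight (sym full))

      source-unique : ∀ v → IsSource R v → v ≡ s
      source-unique v source with pos v | ix-pos v | pos<N v
      ... | zero  | ix0≡v  | _  = sym ix0≡v
      ... | suc k | ixsk≡v | k< =
        ⊥-elim (not-¬ (trans (sym (cong (R (ix k)) ixsk≡v)) (along k k<)) (source (ix k)))

      sink-unique : ∀ v → IsSink R v → v ≡ t
      sink-unique v sink with m≤n⇒m<n∨m≡n (<N⇒≤T (pos<N v))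
      ... | inj₂ at-T = trans (sym (ix-pos v)) (trans (cong ix at-T) ix-T)
      ... | inj₁ <T   = ⊥-elim (not-¬ (subst (λ u → R u (ix (suc (pos v))) ≡ true) (ix-pos v) (along (pos v) (≤T⇒<N <T)))
                                       (sink (ix (suc (pos v)))))

module HamiltonianCycle {n : ℕ} (G : Graph n) (s t : Fin n) (mid : List (Fin n))
  (cycle : IsCycle G (s ∷ mid ++ t ∷ [])) (covers : ∀ v → v ∈ s ∷ mid ++ t ∷ [])
  (closing : adj G t s ≡ true) where

  open HamiltonianList s t mid (proj₁ (proj₂ cycle)) covers public

  2≤T : 2 ≤ T
  2≤T = ≤-pred (subst (3 ≤_) N≡1+T (proj₁ cycle))

  adj-consecutive : ∀ a → suc a < N → adj G (ix a) (ix (suc a)) ≡ true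
  adj-consecutive a = get-linked s (linked-++⁻ˡ L (proj₂ (proj₂ cycle)))

  next : ℕ → ℕ
  next k with k ≟ T
  ... | yes _ = 0
  ... | no  _ = suc k

  prev : ℕ → ℕ
  prev zero    = T
  prev (suc k) = k

  next-T : next T ≡ 0
  next-T with T ≟ T
  ... | yes _   = refl
  ... | no  T≢T = ⊥-elim (T≢T refl)

  next-<T : ∀ {k} → k < T → next k ≡ suc k
  next-<T {k} k<T with k ≟ T
  ... | yes k≡T = ⊥-elim (<-irrefl k≡T k<T)
  ... | no  _   = refl

  <T⊎≡T : ∀ {k} → k < N → k < T ⊎ k ≡ T
  <T⊎≡T k< = m≤n⇒m<n∨m≡n (<N⇒≤T k<)

  next<N : ∀ {k} → k < N → next k < N
  next<N k< with <T⊎≡T k<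
  ... | inj₁ k<T  rewrite next-<T k<T = ≤T⇒<N k<T
  ... | inj₂ refl rewrite next-T      = 0<N

  prev<N : ∀ {k} → k < N → prev k < N
  prev<N {zero}  _  = T<N
  prev<N {suc k} k< = <⇒≤ k<

  prev-next : ∀ {k} → k < N → prev (next k) ≡ k
  prev-next k< with <T⊎≡T k<
  ... | inj₁ k<T  rewrite next-<T k<T = refl
  ... | inj₂ refl rewrite next-T      = refl

  next-prev : ∀ {k} → k < N → next (prev k) ≡ k
  next-prev {zero}  _  = next-T
  next-prev {suc k} k< = next-<T (<N⇒≤T k<)

  adj-next : ∀ {k} → k < N → adj G (ix k) (ix (next k)) ≡ true
  adj-next {k} k< with <T⊎≡T k<
  ... | inj₁ k<T  rewrite next-<T k<T = adj-consecutive k (≤T⇒<N k<T)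
  ... | inj₂ refl rewrite next-T      = subst (λ v → adj G v s ≡ true) (sym ix-T) closing

  adj-prev : ∀ {k} → k < N → adj G (ix k) (ix (prev k)) ≡ true
  adj-prev {k} k< = trans (symm G (ix k) (ix (prev k)))
    (subst (λ a → adj G (ix (prev k)) (ix a) ≡ true) (next-prev k<) (adj-next (prev<N k<)))

  module Bipartition (c : Fin n → Bool) (proper : ∀ u w → adj G u w ≡ true → c u ≢ c w) where

    colour-ix : ∀ a → a < N → c (ix a) ≡ c s xor odd a
    colour-ix zero    _  = sym (xor-identityʳ (c s))
    colour-ix (suc a) a< = begin
      c (ix (suc a))       ≡⟨ ¬-not (λ e → proper _ _ (adj-consecutive a a<) (sym e)) ⟩
      not (c (ix a))       ≡⟨ cong not (colour-ix a (<⇒≤ a<)) ⟩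
      not (c s xor odd a)  ≡⟨ not-distribʳ-xor (c s) (odd a) ⟩
      c s xor odd (suc a)  ∎
      where open ≡-Reasoning

    odd-≢ : ∀ {a b} → a < N → b < N → adj G (ix a) (ix b) ≡ true → odd a ≢ odd b
    odd-≢ {a} {b} a< b< edge same =
      proper _ _ edge (trans (colour-ix a a<) (trans (cong (c s xor_) same) (sym (colour-ix b b<))))

    odd-T : odd T ≡ true
    odd-T = ¬-not (odd-≢ T<N 0<N (subst (λ v → adj G v s ≡ true) (sym ix-T) closing))

  -- T = N − 1, so odd T says that H has even length.
  module EvenLength (odd-T : odd T ≡ true) where

    odd-next : ∀ {k} → k < N → odd (next k) ≡ not (odd k)
    odd-next k< with <T⊎≡T k<
    ... | inj₁ k<T  rewrite next-<T k<T = refl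
    ... | inj₂ refl rewrite next-T      = cong not (sym odd-T)

    odd-prev : ∀ {k} → k < N → odd (prev k) ≡ not (odd k)
    odd-prev {zero}  _ = odd-T
    odd-prev {suc k} _ = sym (not-involutive (odd k))

    -- A perfect matching of the positions outside j … i: each is paired with its cyclic successor
    -- if it has the parity of j and with its cyclic predecessor otherwise.
    module ChordMatching (j i : ℕ) (i<N : i < N) (parity : odd i ≢ odd j) where

      mate : ℕ → ℕ
      mate k = if odd k xor odd j then prev k else next k

      mate-prev : ∀ {k} → odd k xor odd j ≡ true → mate k ≡ prev k
      mate-prev e rewrite e = refl

      mate-next : ∀ {k} → odd k xor odd j ≡ false → mate k ≡ next k
      mate-next e rewrite e = refl

      parity-flips : ∀ {k l} → odd l ≡ not (odd k) → odd l xor odd j ≡ not (odd k xor odd j)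
      parity-flips {k} flip = trans (cong (_xor odd j) flip) (sym (not-distribˡ-xor (odd k) (odd j)))

      mate<N : ∀ {k} → k < N → mate k < N
      mate<N {k} k< with odd k xor odd j
      ... | true  = prev<N k<
      ... | false = next<N k<

      mate-involutive : ∀ {k} → k < N → mate (mate k) ≡ k
      mate-involutive {k} k< with odd k xor odd j in e
      ... | true  = trans (mate-next {prev k} (trans (parity-flips {k} {prev k} (odd-prev k<)) (cong not e))) (next-prev k<)
      ... | false = trans (mate-prev {next k} (trans (parity-flips {k} {next k} (odd-next k<)) (cong not e))) (prev-next k<)

      adj-mate : ∀ {k} → k < N → adj G (ix k) (ix (mate k)) ≡ true
      adj-mate {k} k< with odd k xor odd j
      ... | true  = adj-prev k<
      ... | false = adj-next k<

      Outside : ℕ → Set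
      Outside k = k < j ⊎ i < k

      mate-outside : ∀ {k} → k < N → Outside k → Outside (mate k)
      mate-outside {k} k< out with odd k xor odd j in e
      mate-outside {zero}  k< out           | true =
        inj₂ (≤∧≢⇒< (<N⇒≤T i<N) λ i≡T → parity (trans (cong odd i≡T) (trans odd-T (sym e))))
      mate-outside {suc k} k< (inj₁ sk<j)   | true = inj₁ (<⇒≤ sk<j)
      mate-outside {suc k} k< (inj₂ i<sk)   | true with m≤n⇒m<n∨m≡n (≤-pred i<sk)
      ... | inj₁ i<k  = inj₂ i<k
      ... | inj₂ refl = ⊥-elim (parity (not-xor≡true⇒≡ (trans (not-distribˡ-xor (odd i) (odd j)) e)))
      mate-outside {k}     k< out           | false with <T⊎≡T k<
      mate-outside {k} k< (inj₂ i<k) | false | inj₁ k<T rewrite next-<T k<T = inj₂ (m<n⇒m<1+n i<k)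
      mate-outside {k} k< (inj₁ k<j) | false | inj₁ k<T rewrite next-<T k<T with m≤n⇒m<n∨m≡n k<j
      ... | inj₁ sk<j = inj₁ sk<j
      ... | inj₂ refl = ⊥-elim (not-¬ (xor-inverseʳ (odd k)) e)
      mate-outside {k} k< out        | false | inj₂ refl rewrite next-T =
        inj₁ (n≢0⇒n>0 λ j≡0 → not-¬ (trans (cong (_xor false) (sym odd-T)) (subst (λ b → odd T xor odd b ≡ false) j≡0 e)) refl)

    chord-central : ∀ j m → 2 ≤ m → j + m < N → odd (j + m) ≢ odd j →
      adj G (ix (j + m)) (ix j) ≡ true → Central G (segment j m)
    chord-central j m 2≤m j+m<N parity chord = is-cycle , (λ v → ix (mate (pos v))) , matched
      where
      open ChordMatching j (j + m) j+m<N parity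

      is-cycle : IsCycle G (segment j m)
      is-cycle = subst (3 ≤_) (sym (length-applyUpTo (λ a → ix (j + a)) (suc m))) (s≤s 2≤m) ,
                 segment-unique j m j+m<N ,
                 linked-close-segment j m j+m<N adj-consecutive chord

      outside-pos : ∀ v → v ∉ segment j m → Outside (pos v)
      outside-pos v v∉ with pos v <? j | j + m <? pos v
      ... | yes v<j | _        = inj₁ v<j
      ... | no  _   | yes i<v  = inj₂ i<v
      ... | no  v≮j | no  v≮i  = ⊥-elim (v∉ (subst (_∈ segment j m) (ix-pos v) (∈-segment⁺ {j} {pos v} {m} (≮⇒≥ v≮j) (≮⇒≥ v≮i))))

      outside-∉ : ∀ {a} → a < N → Outside a → ix a ∉ segment j m
      outside-∉ a< out a∈ with ∈-segment⁻ j a∈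
      ... | b , b≤m , e with ix-injective {b = j + b} a< (≤-<-trans (+-monoʳ-≤ j b≤m) j+m<N) e
      ... | refl = [ (λ j+b<j → <⇒≱ j+b<j (m≤m+n j b)) , (λ i<j+b → <⇒≱ i<j+b (+-monoʳ-≤ j b≤m)) ]′ out

      matched : ∀ v → v ∉ segment j m →
        ix (mate (pos v)) ∉ segment j m × ix (mate (pos (ix (mate (pos v))))) ≡ v × adj G v (ix (mate (pos v))) ≡ true
      matched v v∉ =
        outside-∉ (mate<N (pos<N v)) (mate-outside (pos<N v) (outside-pos v v∉)) ,
        trans (cong (ix ∘ mate) (pos-ix (mate<N (pos<N v))))
              (trans (cong ix (mate-involutive (pos<N v))) (ix-pos v)) ,
        subst (λ u → adj G u (ix (mate (pos v))) ≡ true) (ix-pos v) (adj-mate (pos<N v))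

module InducedOrientation {n : ℕ} (G : Graph n) (D : Digraph n) (s t : Fin n) (χ : Fin n → Bool)
  (bipartite : Bipartite G) (pfaffian : IsPfaffian G D) (st-edge : adj G s t ≡ true)
  (mid : List (Fin n)) (cycle : IsCycle G (s ∷ mid ++ t ∷ [])) (covers : ∀ v → v ∈ s ∷ mid ++ t ∷ [])
  (colouring : Linked (λ a b → χ b ≡ χ a xor flipArc D s t a b) (s ∷ mid ++ t ∷ [])) where

  open HamiltonianCycle G s t mid cycle covers (trans (symm G t s) st-edge) public
  open Bipartition (proj₁ bipartite) (proj₂ bipartite)
  open EvenLength odd-T

  F D' : Digraph n
  F  = flipArc D s t
  D' = removeArc (induced G D s t χ) t s

  D'⁻ : ∀ {u w} → D' u w ≡ true → (adj G u w ≡ true × χ w ≡ χ u xor F u w) × ¬ (u ≡ t × w ≡ s)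
  D'⁻ {u} {w} arc = induced⁻ {G = G} {D} {s} {t} {χ} (proj₁ kept) , proj₂ kept
    where
    kept : induced G D s t χ u w ≡ true × ¬ (u ≡ t × w ≡ s)
    kept = removeArc⁻ {E = induced G D s t χ} arc

  D'⁺ : ∀ {u w} → adj G u w ≡ true → χ w ≡ χ u xor F u w → u ≢ t → D' u w ≡ true
  D'⁺ {u} {w} edge agrees = removeArc⁺ {E = induced G D s t χ} {t} {s} {u} {w} (induced⁺ {G = G} {D} {s} {t} {χ} edge agrees)

  colour-step : ∀ a → suc a < N → χ (ix (suc a)) ≡ χ (ix a) xor F (ix a) (ix (suc a))
  colour-step a = get-linked s colouring

  F-consecutive : ∀ a → suc a < N → F (ix a) (ix (suc a)) ≡ D (ix a) (ix (suc a))
  F-consecutive a sa< = flipArc-away D not-st not-ts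
    where
    not-st : ¬ (ix a ≡ s × ix (suc a) ≡ t)
    not-st (a-at-s , sa-at-t) with ix≡s⇒0 (<⇒≤ sa<) a-at-s
    ... | refl = <-irrefl (ix≡t⇒T sa< sa-at-t) 2≤T
    not-ts : ¬ (ix a ≡ t × ix (suc a) ≡ s)
    not-ts (a-at-t , _) = <-irrefl (ix≡t⇒T (<⇒≤ sa<) a-at-t) (<N⇒≤T sa<)

  D'-consecutive : ∀ a → suc a < N → D' (ix a) (ix (suc a)) ≡ true
  D'-consecutive a sa< = D'⁺ (adj-consecutive a sa<) (colour-step a sa<)
    (λ a-at-t → <-irrefl (ix≡t⇒T (<⇒≤ sa<) a-at-t) (<N⇒≤T sa<))

  no-loop : ∀ u → D' u u ≢ true
  no-loop u arc = not-¬ (proj₁ (proj₁ (D'⁻ arc))) (irrefl G u)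

  no-adjacent-back-arc : ∀ j → suc j < N → D' (ix (suc j)) (ix j) ≢ true
  no-adjacent-back-arc j sj< arc =
    not-¬ (flipArc-antisym {G = G} {D} (proj₁ pfaffian) s t (adj-consecutive j sj<)) (xor-round-trip _ _ _ round-trip)
    where
    round-trip : χ (ix j) ≡ (χ (ix j) xor F (ix j) (ix (suc j))) xor F (ix (suc j)) (ix j)
    round-trip = trans (proj₂ (proj₁ (D'⁻ arc))) (cong (_xor F (ix (suc j)) (ix j)) (colour-step j sj<))

  no-chord-back-arc : ∀ j m → 2 ≤ m → j + m < N → D' (ix (j + m)) (ix j) ≢ true
  no-chord-back-arc j m 2≤m j+m<N arc = not-¬ odd-count even-count
    where
    j<N : j < N
    j<N = ≤-<-trans (m≤m+n j m) j+m<N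
    chord : adj G (ix (j + m)) (ix j) ≡ true × χ (ix j) ≡ χ (ix (j + m)) xor F (ix (j + m)) (ix j)
    chord = proj₁ (D'⁻ arc)
    F-chord : F (ix (j + m)) (ix j) ≡ D (ix (j + m)) (ix j)
    F-chord = flipArc-away D
      (λ (i-at-s , _) → n≮0 (subst (2 ≤_) (ix≡s⇒0 j+m<N i-at-s) (≤-trans 2≤m (m≤n+m m j))))
      (proj₂ (D'⁻ arc))
    central : Central G (segment j m)
    central = chord-central j m 2≤m j+m<N (odd-≢ j+m<N j<N (proj₁ chord)) (proj₁ chord)
    odd-count : odd (countFwd D (pairs (close (segment j m)))) ≡ true
    odd-count = OddN⇒odd (countFwd D (pairs (close (segment j m)))) (proj₁ (proj₂ pfaffian (segment j m) central))
    even-count : odd (countFwd D (pairs (close (segment j m)))) ≡ false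
    even-count = odd-countFwd-closed D χ _ _ (linked-close-segment j m j+m<N
      (λ a sa< → trans (colour-step a sa<) (cong (χ (ix a) xor_) (F-consecutive a sa<)))
      (trans (proj₂ chord) (cong (χ (ix (j + m)) xor_) F-chord)))

  no-back-arc : ∀ {j i} → j ≤ i → i < N → D' (ix i) (ix j) ≢ true
  no-back-arc {j} j≤i i<N with m≤n⇒∃[o]m+o≡n j≤i
  ... | zero          , refl = no-loop (ix j) ∘ subst (λ a → D' (ix a) (ix j) ≡ true) (+-identityʳ j)
  ... | suc zero      , refl = no-adjacent-back-arc j (subst (_< N) (+-comm j 1) i<N)
                                 ∘ subst (λ a → D' (ix a) (ix j) ≡ true) (+-comm j 1)
  ... | suc (suc o)   , refl = no-chord-back-arc j (suc (suc o)) (s≤s (s≤s z≤n)) i<N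

  forward : ∀ u w → D' u w ≡ true → pos u < pos w
  forward u w arc with pos w ≤? pos u
  ... | no  w≰u = ≰⇒> w≰u
  ... | yes w≤u = ⊥-elim (no-back-arc w≤u (pos<N u)
                    (subst₂ (λ a b → D' a b ≡ true) (sym (ix-pos u)) (sym (ix-pos w)) arc))

  open ForwardArcs D' forward public

lemma2p1 : {n : ℕ} (G : Graph n) (D : Digraph n) (s t : Fin n) (χ : Fin n → Bool) →
    Bipartite G → IsPfaffian G D →
    adj G s t ≡ true → D s t ≡ true →
    GoodColoring G D s t χ →
    let D' = removeArc (induced G D s t χ) t s in
      Acyclic D' × UniqueSource D' s × UniqueSink D' t
      × Σ (List (Fin n)) (λ P → IsLongestPath D' P
          × (∀ Q → IsLongestPath D' Q → Q ≡ P)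
          × IsHamiltonianPath D' P)
-- The hypotheses (s,t) ∈ G⃗ and χ(s) = 0 only fix conventions; the argument does not use them.
lemma2p1 G D s t χ bipartite pfaffian st-edge _ (mid , cycle , covers , _ , colouring) =
  acyclic , (s-source , source-unique D'-consecutive) , (t-sink , sink-unique D'-consecutive) ,
  L , L-longest D'-consecutive , longest-unique D'-consecutive , (L-path D'-consecutive , covers)
  where open InducedOrientation G D s t χ bipartite pfaffian st-edge mid cycle covers colouring
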